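{- Let $G$ be a clockwise blue-red hackenbush position. (1) Left's move of deleting the topmost blue edge on the trunk dominates all other Left options, and Right's move of deleting the topmost red edge on the trunk dominates all other Right options. (2) The value of $G$ is a number.
   Context: A clockwise blue-red hackenbush position is a finite tree rooted at a ground vertex and embedded in the plane (child edges at each vertex ordered left to right), each edge coloured blue or red. The trunk is the path from the ground obtained by repeatedly following the rightmost edge to a child until a leaf. Left may remove a blue trunk edge, Right a red trunk edge; afterwards everything disconnected from the ground is removed and the trunk is recomputed. Normal play convention. An option dominates another option of the same player if it is at least as good for that player (greater or equal for Left, less or equal for Right). -}

module Defs where

open import Data.Nat using (ℕ; zero; suc; _+_)
open import Data.Fin using (Fin; zero; suc)
open import Data.List using (List; []; _∷_; length; map; filter; allFin; lookup)
open import Data.Product using (_×_; _,_; Σ)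
open import Relation.Nullary using (¬_; Dec; yes; no)
open import Relation.Binary.PropositionalEquality using (_≡_; refl)

data Colour : Set where
  blue red : Colour

_≟C_ : (c d : Colour) → Dec (c ≡ d)
blue ≟C blue = yes refl
blue ≟C red  = no λ ()
red  ≟C blue = no λ ()
red  ≟C red  = yes refl

-- A clockwise blue-red hackenbush position: a finite plane tree rooted at
-- the ground vertex.
-- CONVENTION: the children are listed from RIGHT to LEFT, i.e. the head of
-- the list is the rightmost child edge.
data Tree : Set where
  node : List (Colour × Tree) → Tree

-- Colours of the trunk edges, listed from the ground upwards
-- (repeatedly follow the rightmost child edge until a leaf).
trunk : Tree → List Colour
trunk (node [])              = []
trunk (node ((c , t) ∷ _))   = c ∷ trunk t

-- Removing the trunk edge with index i (0 = the trunk edge at the ground);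
-- everything above it becomes disconnected and is removed.
cut : (t : Tree) → Fin (length (trunk t)) → Tree
cut (node ((c , t) ∷ rest)) zero    = node rest
cut (node ((c , t) ∷ rest)) (suc i) = node ((c , cut t i) ∷ rest)

mutual
  edges : Tree → ℕ
  edges (node cs) = edgesF cs

  edgesF : List (Colour × Tree) → ℕ
  edgesF []             = 0
  edgesF ((_ , t) ∷ cs) = suc (edges t + edgesF cs)

-- Options for the player who may remove edges of colour c
-- (Left: blue, Right: red).
options : Colour → Tree → List Tree
options c t =
  map (cut t) (filter (λ i → lookup (trunk t) i ≟C c) (allFin (length (trunk t))))

data Game : Set where
  mk : {m n : ℕ} → (Fin m → Game) → (Fin n → Game) → Game

_≤G_ : Game → Game → Set
mk L R ≤G mk L' R' =
  ((i : _) → ¬ (mk L' R' ≤G L i)) × ((j : _) → ¬ (R' j ≤G mk L R))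

_≈G_ : Game → Game → Set
G ≈G H = (G ≤G H) × (H ≤G G)

IsNumeric : Game → Set
IsNumeric (mk L R) =
  ((i : _) → IsNumeric (L i)) × ((j : _) → IsNumeric (R j))
  × ((i : _) (j : _) → ¬ (R j ≤G L i))

IsNumberValued : Game → Set
IsNumberValued G = Σ Game λ H → IsNumeric H × (G ≈G H)

-- The game of a position.  The fuel n only has to be at least the number
-- of edges (each move removes at least one edge), so `value` is the
-- usual recursively defined game { G^L | G^R }.

gameOf : ℕ → Tree → Game
gameOf zero    t = mk {0} {0} (λ ()) (λ ())
gameOf (suc n) t =
  mk (λ i → gameOf n (lookup (options blue t) i))
     (λ j → gameOf n (lookup (options red t) j))

value : Tree → Game
value t = gameOf (edges t) t

-- For trunk edges i below j, removing i from t gives the same position as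
-- removing i from what is left after removing j: the position after cutting
-- the lower edge is an option of the position after cutting the higher one.
-- So of a Left option cut t i and a Right option cut t j of t one is always an
-- option of the other, hence never Gᴿ ≤ Gᴸ, and by induction every
-- position is numeric.  In a numeric game every Left option lies below the
-- game, which gives the domination by the topmost blue (dually red) edge.

module Submission where

open import Defs
open import Data.Nat using (ℕ; zero; suc; _≤_; _<_; s≤s)
open import Data.Nat.Properties using (≤-refl; ≤-pred; <-≤-trans; m≤n+m; +-monoˡ-<)
open import Data.Fin using (Fin; toℕ; zero; suc)
open import Data.Fin.Properties using (<-cmp; ≤∧≢⇒<) renaming (_≟_ to _≟F_)
open import Data.List using ([]; _∷_; length; lookup; allFin)
open import Data.List.Membership.Propositional using (_∈_)
open import Data.List.Membership.Propositional.Properties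
  using (∈-map⁺; ∈-filter⁺; ∈-allFin; ∈-lookup; ∈-map∘filter⁻)
open import Data.List.Relation.Unary.Any using (index)
open import Data.List.Relation.Unary.Any.Properties using (lookup-index)
open import Data.Product using (_×_; _,_; Σ; ∃-syntax; proj₁; proj₂)
open import Relation.Nullary using (¬_; yes; no)
open import Relation.Binary using (tri<; tri≈; tri>)
open import Relation.Binary.PropositionalEquality using (_≡_; refl; sym; trans; cong; subst)

private
  variable
    m n : ℕ
    L L' : Fin m → Game
    R R' : Fin n → Game
    G H K X : Game

≤G-leftInv : mk L R ≤G H → ∀ i → ¬ (H ≤G L i)
≤G-leftInv {H = mk _ _} = proj₁

≤G-rightInv : H ≤G mk L R → ∀ j → ¬ (R j ≤G H)
≤G-rightInv {H = mk _ _} = proj₂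

≤G-refl : ∀ G → G ≤G G
≤G-refl (mk L R) =
  (λ i G≤Li → ≤G-leftInv G≤Li i (≤G-refl (L i))) ,
  (λ j Rj≤G → ≤G-rightInv Rj≤G j (≤G-refl (R j)))

≤G-trans : G ≤G H → H ≤G K → G ≤G K
≤G-trans {mk L R} {mk _ _} {mk _ RK} G≤H@(G≱L , _) H≤K@(_ , K≱R) =
  (λ i K≤Li → G≱L i (≤G-trans H≤K K≤Li)) ,
  (λ j RKj≤G → K≱R j (≤G-trans RKj≤G G≤H))

leftOption-≱ : ∀ i → ¬ (mk L R ≤G L i)
leftOption-≱ {L = L} i G≤Li = ≤G-leftInv G≤Li i (≤G-refl (L i))

rightOption-≰ : ∀ j → ¬ (R j ≤G mk L R)
rightOption-≰ {R = R} j Rj≤G = ≤G-rightInv Rj≤G j (≤G-refl (R j))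

-- For numeric X the Left options of X lie below X, so in X ≤ G the
-- condition "G ≰ Xᴸ for all Xᴸ" follows from G ≰ X.
numeric-≤G : IsNumeric X → ¬ (mk L R ≤G X) → (∀ j → ¬ (R j ≤G X)) → X ≤G mk L R
numeric-≤G {mk a b} (numA , _ , b≰a) G≰X R≰X =
  (λ k G≤ak → G≰X (≤G-trans G≤ak (numeric-≤G (numA k) (leftOption-≱ k) (b≰a k)))) ,
  R≰X

numeric-≥G : IsNumeric X → ¬ (X ≤G mk L R) → (∀ i → ¬ (X ≤G L i)) → mk L R ≤G X
numeric-≥G {mk a b} (_ , numB , b≰a) X≰G X≰L =
  X≰L ,
  (λ k bk≤G → X≰G (≤G-trans (numeric-≥G (numB k) (rightOption-≰ k) (λ i → b≰a i k)) bk≤G))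

-- Pointwise identity of game forms, standing in for _≡_ without function extensionality.
data _≃_ : Game → Game → Set where
  mk≃ : (∀ i → L i ≃ L' i) → (∀ j → R j ≃ R' j) → mk L R ≃ mk L' R'

≃-sym : G ≃ H → H ≃ G
≃-sym (mk≃ L≃ R≃) = mk≃ (λ i → ≃-sym (L≃ i)) (λ j → ≃-sym (R≃ j))

≃⇒≤G : G ≃ H → G ≤G H
≃⇒≤G (mk≃ L≃ R≃) =
  (λ i H≤Li → leftOption-≱ i (≤G-trans H≤Li (≃⇒≤G (L≃ i)))) ,
  (λ j R'j≤G → rightOption-≰ j (≤G-trans (≃⇒≤G (R≃ j)) R'j≤G))

≃⇒≈G : G ≃ H → G ≈G H
≃⇒≈G G≃H = ≃⇒≤G G≃H , ≃⇒≤G (≃-sym G≃H)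

_∈ᴸ_ : Game → Game → Set
H ∈ᴸ mk L R = ∃[ i ] L i ≈G H

_∈ᴿ_ : Game → Game → Set
H ∈ᴿ mk L R = ∃[ j ] R j ≈G H

∈ᴸ⇒≱ : H ∈ᴸ G → ¬ (G ≤G H)
∈ᴸ⇒≱ {G = mk _ _} (i , _ , H≤Li) G≤H = leftOption-≱ i (≤G-trans G≤H H≤Li)

∈ᴿ⇒≰ : H ∈ᴿ G → ¬ (H ≤G G)
∈ᴿ⇒≰ {G = mk _ _} (j , Rj≤H , _) H≤G = rightOption-≰ j (≤G-trans Rj≤H H≤G)

numeric-∈ᴸ⇒≤ : IsNumeric G → H ∈ᴸ G → H ≤G G
numeric-∈ᴸ⇒≤ {mk L R} (numL , _ , R≰L) (i , _ , H≤Li) =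
  ≤G-trans H≤Li (numeric-≤G (numL i) (leftOption-≱ i) (R≰L i))

numeric-∈ᴿ⇒≥ : IsNumeric G → H ∈ᴿ G → G ≤G H
numeric-∈ᴿ⇒≥ {mk L R} (_ , numR , R≰L) (j , Rj≤H , _) =
  ≤G-trans (numeric-≥G (numR j) (rightOption-≰ j) (λ i → R≰L i j)) Rj≤H

colour : (t : Tree) → Fin (length (trunk t)) → Colour
colour t = lookup (trunk t)

cut-cut : (t : Tree) {i j : Fin (length (trunk t))} → toℕ i < toℕ j →
  Σ (Fin (length (trunk (cut t j)))) λ i' → colour (cut t j) i' ≡ colour t i × cut (cut t j) i' ≡ cut t i
cut-cut (node ((c , u) ∷ rest)) {zero}  {suc j} _ = zero , refl , refl
cut-cut (node ((c , u) ∷ rest)) {suc i} {suc j} (s≤s i<j) with cut-cut u i<j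
... | i' , same-colour , same-cut = suc i' , same-colour , cong (λ v → node ((c , v) ∷ rest)) same-cut

edges-cut : (t : Tree) (i : Fin (length (trunk t))) → edges (cut t i) < edges t
edges-cut (node ((c , u) ∷ rest)) zero    = s≤s (m≤n+m (edgesF rest) (edges u))
edges-cut (node ((c , u) ∷ rest)) (suc i) = s≤s (+-monoˡ-< (edgesF rest) (edges-cut u i))

cut∈options : ∀ c (t : Tree) {i} → colour t i ≡ c → cut t i ∈ options c t
cut∈options c t {i} colour≡c =
  ∈-map⁺ (cut t) (∈-filter⁺ (λ k → colour t k ≟C c) (∈-allFin i) colour≡c)

∈options⁻ : ∀ c (t : Tree) {u} → u ∈ options c t →
  ∃[ i ] colour t i ≡ c × u ≡ cut t i
∈options⁻ c t u∈ with ∈-map∘filter⁻ (cut t) (λ k → colour t k ≟C c) {xs = allFin _} u∈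
... | i , _ , u≡cut , colour≡c = i , colour≡c , u≡cut

option-edges : ∀ c (t : Tree) {u} → edges t ≤ suc n → u ∈ options c t → edges u ≤ n
option-edges c t t≤1+n u∈ with ∈options⁻ c t u∈
... | i , _ , refl = ≤-pred (<-≤-trans (edges-cut t i) t≤1+n)

gameOf-fuel : ∀ m n (t : Tree) → edges t ≤ m → edges t ≤ n → gameOf m t ≃ gameOf n t
gameOf-fuel zero    zero    (node []) _ _ = mk≃ (λ ()) (λ ())
gameOf-fuel zero    (suc _) (node []) _ _ = mk≃ (λ ()) (λ ())
gameOf-fuel (suc _) zero    (node []) _ _ = mk≃ (λ ()) (λ ())
gameOf-fuel (suc _) (suc _) (node []) _ _ = mk≃ (λ ()) (λ ())
gameOf-fuel (suc m) (suc n) t@(node (_ ∷ _)) t≤1+m t≤1+n =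
  mk≃ (λ k → fuel blue k) (λ k → fuel red k)
  where
  fuel : ∀ c k → gameOf m (lookup (options c t) k) ≃ gameOf n (lookup (options c t) k)
  fuel c k = gameOf-fuel m n _ (option-edges c t t≤1+m (∈-lookup k)) (option-edges c t t≤1+n (∈-lookup k))

gameOf≈value : (t : Tree) → edges t ≤ n → gameOf n t ≈G value t
gameOf≈value {n} t t≤n = ≃⇒≈G (gameOf-fuel n (edges t) t t≤n ≤-refl)

value-cut-option : ∀ c (t : Tree) {i} → colour t i ≡ c → edges t ≤ suc n →
  ∃[ k ] gameOf n (lookup (options c t) k) ≈G value (cut t i)
value-cut-option c t {i} colour≡c t≤1+n =
  index cut∈ ,
  subst (λ u → gameOf _ u ≈G value (cut t i)) (lookup-index cut∈)
    (gameOf≈value (cut t i) (option-edges c t t≤1+n cut∈))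
  where
  cut∈ : cut t i ∈ options c t
  cut∈ = cut∈options c t colour≡c

value-cut-∈ᴸ : (t : Tree) {i : Fin (length (trunk t))} → colour t i ≡ blue → value (cut t i) ∈ᴸ value t
value-cut-∈ᴸ (node []) {()}
value-cut-∈ᴸ t@(node (_ ∷ _)) blue-i = value-cut-option blue t blue-i ≤-refl

value-cut-∈ᴿ : (t : Tree) {j : Fin (length (trunk t))} → colour t j ≡ red → value (cut t j) ∈ᴿ value t
value-cut-∈ᴿ (node []) {()}
value-cut-∈ᴿ t@(node (_ ∷ _)) red-j = value-cut-option red t red-j ≤-refl

-- Whichever of the two edges is lower, cutting it is an option of the
-- position left after cutting the other one.
cut-red≰cut-blue : (t : Tree) {i j : Fin (length (trunk t))} → colour t i ≡ blue → colour t j ≡ red →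
  ¬ (value (cut t j) ≤G value (cut t i))
cut-red≰cut-blue t {i} {j} blue-i red-j with <-cmp i j
... | tri≈ _ refl _ with trans (sym blue-i) red-j
...   | ()
cut-red≰cut-blue t {i} {j} blue-i red-j | tri< i<j _ _ with cut-cut t i<j
... | i' , same-colour , same-cut =
  ∈ᴸ⇒≱ (subst (λ u → value u ∈ᴸ value (cut t j)) same-cut
          (value-cut-∈ᴸ (cut t j) (trans same-colour blue-i)))
cut-red≰cut-blue t {i} {j} blue-i red-j | tri> _ _ j<i with cut-cut t j<i
... | j' , same-colour , same-cut =
  ∈ᴿ⇒≰ (subst (λ u → value u ∈ᴿ value (cut t i)) same-cut
          (value-cut-∈ᴿ (cut t i) (trans same-colour red-j)))

gameOf-numeric : ∀ n (t : Tree) → edges t ≤ n → IsNumeric (gameOf n t)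
gameOf-numeric zero    t _       = (λ ()) , (λ ()) , λ ()
gameOf-numeric (suc n) t t≤1+n =
  (λ k → gameOf-numeric n _ (option-edges blue t t≤1+n (∈-lookup k))) ,
  (λ k → gameOf-numeric n _ (option-edges red t t≤1+n (∈-lookup k))) ,
  right≰left
  where
  option≈value : ∀ c k → gameOf n (lookup (options c t) k) ≈G value (lookup (options c t) k)
  option≈value c k = gameOf≈value _ (option-edges c t t≤1+n (∈-lookup k))

  red≰blue : ∀ {u v} → u ∈ options blue t → v ∈ options red t → ¬ (value v ≤G value u)
  red≰blue u∈ v∈ with ∈options⁻ blue t u∈ | ∈options⁻ red t v∈
  ... | i , blue-i , refl | j , red-j , refl = cut-red≰cut-blue t blue-i red-j

  right≰left : ∀ k l → ¬ (gameOf n (lookup (options red t) l) ≤G gameOf n (lookup (options blue t) k))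
  right≰left k l Rl≤Lk =
    red≰blue (∈-lookup k) (∈-lookup l)
      (≤G-trans (proj₂ (option≈value red l)) (≤G-trans Rl≤Lk (proj₁ (option≈value blue k))))

value-numeric : (t : Tree) → IsNumeric (value t)
value-numeric t = gameOf-numeric (edges t) t ≤-refl

cut-blue-≤-higher-cut : (t : Tree) {i top : Fin (length (trunk t))} → colour t i ≡ blue →
  toℕ i ≤ toℕ top → value (cut t i) ≤G value (cut t top)
cut-blue-≤-higher-cut t {i} {top} blue-i i≤top with i ≟F top
... | yes refl = ≤G-refl _
... | no i≢top with cut-cut t (≤∧≢⇒< i≤top i≢top)
...   | i' , same-colour , same-cut =
  subst (λ u → value u ≤G value (cut t top)) same-cut
    (numeric-∈ᴸ⇒≤ (value-numeric _) (value-cut-∈ᴸ (cut t top) (trans same-colour blue-i)))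

cut-red-≥-higher-cut : (t : Tree) {i top : Fin (length (trunk t))} → colour t i ≡ red →
  toℕ i ≤ toℕ top → value (cut t top) ≤G value (cut t i)
cut-red-≥-higher-cut t {i} {top} red-i i≤top with i ≟F top
... | yes refl = ≤G-refl _
... | no i≢top with cut-cut t (≤∧≢⇒< i≤top i≢top)
...   | i' , same-colour , same-cut =
  subst (λ u → value (cut t top) ≤G value u) same-cut
    (numeric-∈ᴿ⇒≥ (value-numeric _) (value-cut-∈ᴿ (cut t top) (trans same-colour red-i)))

corollary2p4 : (t : Tree) →
    ((top : Fin (length (trunk t))) → lookup (trunk t) top ≡ blue →
      ((i : Fin (length (trunk t))) → lookup (trunk t) i ≡ blue → toℕ i ≤ toℕ top) →
      (i : Fin (length (trunk t))) → lookup (trunk t) i ≡ blue →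
      value (cut t i) ≤G value (cut t top))
    × ((top : Fin (length (trunk t))) → lookup (trunk t) top ≡ red →
      ((i : Fin (length (trunk t))) → lookup (trunk t) i ≡ red → toℕ i ≤ toℕ top) →
      (i : Fin (length (trunk t))) → lookup (trunk t) i ≡ red →
      value (cut t top) ≤G value (cut t i))
    × IsNumberValued (value t)
corollary2p4 t =
  (λ _ _ below-top i blue-i → cut-blue-≤-higher-cut t blue-i (below-top i blue-i)) ,
  (λ _ _ below-top i red-i → cut-red-≥-higher-cut t red-i (below-top i red-i)) ,
  (value t , value-numeric t , ≤G-refl (value t) , ≤G-refl (value t))
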